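{- Let $\mathcal V=(d,Q,\Delta)$ be a VASS, let $s_0\in Q$, $\mathbf v_0\in\mathbb N^d$, and let $\rho=(s_0,\mathbf z_0,s_1)(s_1,\mathbf z_1,s_2)\cdots(s_{k-1},\mathbf z_{k-1},s_k)$ be a path of $\mathcal V$. Let $s_0(\mathbf v_0),s_1(\mathbf v_1),\ldots,s_k(\mathbf v_k)$ be the unique run induced by $\rho$ from $s_0(\mathbf v_0)$ in $\mathbb Z$-semantics, and let $s_0(\mathbf v'_0),s_1(\mathbf v'_1),\ldots,s_k(\mathbf v'_k)$ be the unique run induced by $\rho$ from $s_0(\mathbf v'_0)$ in monus semantics, where $\mathbf v'_0=\mathbf v_0$. Define $\mathbf m\in\mathbb Z^d$ by $\mathbf m[i]=\min\bigl(\min_{0\le j\le k}\mathbf v_j[i],\,0\bigr)$ for $i=1,\ldots,d$. Then $\mathbf v'_k=\mathbf v_k-\mathbf m$.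
   Context: A VASS (vector addition system with states) is a triple $\mathcal V=(d,Q,\Delta)$ with $d\in\mathbb N$, $Q$ a finite set of states and $\Delta\subseteq Q\times\mathbb Z^d\times Q$ a finite set of transitions. A path is a sequence of transitions $(p_0,\mathbf z_0,p_1)(p_1,\mathbf z_1,p_2)\cdots(p_{k-1},\mathbf z_{k-1},p_k)$ in which consecutive transitions share the intermediate state. The run induced by such a path from $p_0(\mathbf u_0)$ is the sequence $p_0(\mathbf u_0),\ldots,p_k(\mathbf u_k)$ where: in $\mathbb Z$-semantics, $\mathbf u_i\in\mathbb Z^d$ and $\mathbf u_{i+1}=\mathbf u_i+\mathbf z_i$; in monus semantics, $\mathbf u_i\in\mathbb N^d$ and $\mathbf u_{i+1}=\max(\mathbf u_i+\mathbf z_i,\mathbf 0)$ (componentwise maximum). In both semantics the induced run always exists and is unique. -}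

module Defs where

open import Data.Nat using (ℕ)
open import Data.Integer using (ℤ; +_; _+_; _-_; _⊓_; _⊔_)
open import Data.Fin using (Fin)
open import Data.List using (List; []; _∷_)
open import Data.List.Membership.Propositional using (_∈_)
open import Data.Product using (_×_; _,_)

record VASS : Set where
  field
    d  : ℕ
    nQ : ℕ
    Δ  : List (Fin nQ × (Fin d → ℤ) × Fin nQ)

  State : Set
  State = Fin nQ

  Vec : Set
  Vec = Fin d → ℤ

open VASS public

data Path (V : VASS) : State V → State V → Set where
  []  : ∀ {p} → Path V p p
  _∷_ : ∀ {p q r} {z : Vec V} → (p , z , q) ∈ Δ V → Path V q r → Path V p r

zRun : (V : VASS) {p q : State V} → Path V p q → Vec V → List (Vec V)
zRun V [] u = u ∷ []
zRun V (_∷_ {z = z} _ ρ) u = u ∷ zRun V ρ (λ i → u i + z i)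

zFinal : (V : VASS) {p q : State V} → Path V p q → Vec V → Vec V
zFinal V [] u = u
zFinal V (_∷_ {z = z} _ ρ) u = zFinal V ρ (λ i → u i + z i)

-- monus semantics: u_{i+1} = max(u_i + z_i, 0) componentwise.
-- Counter values are in ℕ^d, represented as ℤ-vectors (entries ≥ 0 by
-- construction); final value of the induced run.
monusFinal : (V : VASS) {p q : State V} → Path V p q → Vec V → Vec V
monusFinal V [] u = u
monusFinal V (_∷_ {z = z} _ ρ) u = monusFinal V ρ (λ i → (u i + z i) ⊔ + 0)

minWith0 : List ℤ → ℤ
minWith0 [] = + 0
minWith0 (x ∷ xs) = x ⊓ minWith0 xs

-- Along a path the monus counter stays equal to the ℤ-counter minus the
-- running minimum m of the ℤ-counter (taken together with 0): if the monus
-- counter is y - m, the next ℤ-value is y' = y + z, and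
-- max(y' - m, 0) = y' - min(m, y'), which is the same shape with the
-- minimum updated by y'.
module Submission where

open import Defs
open import Data.Nat using (ℕ; z≤n)
open import Data.Integer using (ℤ; +_; 0ℤ; _+_; _-_; -_; _⊓_; _⊔_; _≤_; +≤+)
open import Data.Integer.Properties
open import Data.Integer.Tactic.RingSolver using (solve-∀)
open import Data.Fin using (Fin)
open import Data.List using ([]; _∷_; map)
open import Relation.Binary.PropositionalEquality using (_≡_; sym; cong; module ≡-Reasoning)

open ≡-Reasoning

minWith0≤0 : ∀ xs → minWith0 xs ≤ 0ℤ
minWith0≤0 []       = ≤-refl
minWith0≤0 (x ∷ xs) = ≤-trans (i⊓j≤j x (minWith0 xs)) (minWith0≤0 xs)

i≤0⇒i⊓j≤0 : ∀ {i} j → i ≤ 0ℤ → i ⊓ j ≤ 0ℤ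
i≤0⇒i⊓j≤0 {i} j i≤0 = ≤-trans (i⊓j≤i i j) i≤0

runMin : (V : VASS) {p q : State V} → Path V p q → Vec V → Fin (d V) → ℤ
runMin V ρ u i = minWith0 (map (λ w → w i) (zRun V ρ u))

i-j+k≡i+k-j : ∀ i j k → i - j + k ≡ i + k - j
i-j+k≡i+k-j = solve-∀

[i-j]⊔0≡i-[j⊓i] : ∀ i j → (i - j) ⊔ 0ℤ ≡ i - (j ⊓ i)
[i-j]⊔0≡i-[j⊓i] i j = sym (begin
  i - (j ⊓ i)          ≡⟨ cong (_+_ i) (neg-distrib-⊓-⊔ j i) ⟩
  i + (- j ⊔ - i)      ≡⟨ mono-<-distrib-⊔ (_+_ i) (+-monoʳ-< i) (- j) (- i) ⟩
  (i - j) ⊔ (i - i)    ≡⟨ cong ((i - j) ⊔_) (+-inverseʳ i) ⟩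
  (i - j) ⊔ 0ℤ         ∎)

-- c is the minimum of 0 and the ℤ-values strictly before the current one.
monusFinal≡zFinal-runMin : (V : VASS) {p q : State V} (ρ : Path V p q) (i : Fin (d V))
  {a b : Vec V} {c : ℤ} → c ≤ 0ℤ → a i ≡ b i - (c ⊓ b i) →
  monusFinal V ρ a i ≡ zFinal V ρ b i - (c ⊓ runMin V ρ b i)
monusFinal≡zFinal-runMin V [] i {a} {b} {c} c≤0 a≡ = begin
  a i                      ≡⟨ a≡ ⟩
  b i - (c ⊓ b i)          ≡⟨ cong (_-_ (b i)) (i≤j⇒i⊓j≡i (i≤0⇒i⊓j≤0 (b i) c≤0)) ⟨
  b i - (c ⊓ b i ⊓ 0ℤ)     ≡⟨ cong (_-_ (b i)) (⊓-assoc c (b i) 0ℤ) ⟩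
  b i - (c ⊓ (b i ⊓ 0ℤ))   ∎
monusFinal≡zFinal-runMin V (_∷_ {z = z} _ ρ) i {a} {b} {c} c≤0 a≡ = begin
  monusFinal V ρ a′ i                                 ≡⟨ monusFinal≡zFinal-runMin V ρ i (i≤0⇒i⊓j≤0 (b i) c≤0) a′≡ ⟩
  zFinal V ρ b′ i - (c′ ⊓ runMin V ρ b′ i)            ≡⟨ cong (_-_ (zFinal V ρ b′ i)) (⊓-assoc c (b i) _) ⟩
  zFinal V ρ b′ i - (c ⊓ (b i ⊓ runMin V ρ b′ i))     ∎
  where
  a′ b′ : Vec V
  a′ j = (a j + z j) ⊔ 0ℤ
  b′ j = b j + z j
  c′ : ℤ
  c′ = c ⊓ b i
  a′≡ : a′ i ≡ b′ i - (c′ ⊓ b′ i)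
  a′≡ = begin
    (a i + z i) ⊔ 0ℤ         ≡⟨ cong (λ t → (t + z i) ⊔ 0ℤ) a≡ ⟩
    (b i - c′ + z i) ⊔ 0ℤ    ≡⟨ cong (_⊔ 0ℤ) (i-j+k≡i+k-j (b i) c′ (z i)) ⟩
    (b′ i - c′) ⊔ 0ℤ         ≡⟨ [i-j]⊔0≡i-[j⊓i] (b′ i) c′ ⟩
    b′ i - (c′ ⊓ b′ i)       ∎

proposition3 : (V : VASS) (s₀ sₖ : State V) (ρ : Path V s₀ sₖ) (v₀ : Fin (d V) → ℕ) →
    let v = λ i → + (v₀ i)
    in ∀ (i : Fin (d V)) →
      monusFinal V ρ v i ≡ zFinal V ρ v i - minWith0 (map (λ u → u i) (zRun V ρ v))
proposition3 V s₀ sₖ ρ v₀ i = begin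
  monusFinal V ρ v i                          ≡⟨ monusFinal≡zFinal-runMin V ρ i ≤-refl v≡ ⟩
  zFinal V ρ v i - (0ℤ ⊓ runMin V ρ v i)      ≡⟨ cong (_-_ (zFinal V ρ v i)) (i≥j⇒i⊓j≡j (minWith0≤0 (map (λ w → w i) (zRun V ρ v)))) ⟩
  zFinal V ρ v i - runMin V ρ v i             ∎
  where
  v : Vec V
  v j = + (v₀ j)
  v≡ : v i ≡ v i - (0ℤ ⊓ v i)
  v≡ = begin
    v i              ≡⟨ +-identityʳ (v i) ⟨
    v i - 0ℤ         ≡⟨ cong (_-_ (v i)) (i≤j⇒i⊓j≡i (+≤+ (z≤n {v₀ i}))) ⟨
    v i - (0ℤ ⊓ v i) ∎
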